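{- If $\mathcal{B}$ is a normal $\sqrt{\mathfrak{gl}_n}$-crystal, then $\mathsf{rect}(b)$ is a highest weight element for every $b\in\mathcal{B}$.
   Context: $[n]=\{1,\dots,n\}$, $\mathbf{e}_k$ standard basis of $\mathbb{Z}^n$. A $\sqrt{\mathfrak{gl}_n}$-crystal is a set $\mathcal{B}$ with $\mathrm{wt}:\mathcal{B}\to\mathbb{Z}^n$ and $e_i,f_i:\mathcal{B}\to\mathcal{B}\sqcup\{0\}$ ($i\in[n-1]$, $e_i(0)=f_i(0)=0$) such that, with $\varepsilon_i(b)=\sup\{k\ge0:e_i^k(b)\neq0\}$ and $\varphi_i(b)=\sup\{k\ge0:f_i^k(b)\ne0\}$: (a) both are finite and $\frac{\varphi_i(b)-\varepsilon_i(b)}{2}=\mathrm{wt}(b)_i-\mathrm{wt}(b)_{i+1}$; (b) $e_i(b)=c$ iff $f_i(c)=b$, and then $\mathrm{wt}(c)-\mathrm{wt}(b)=\mathbf{e}_i$ if $\varepsilon_i(b)$ even, $-\mathbf{e}_{i+1}$ if odd. Highest weight: $e_i(b)=0$ for all $i$. Full subcrystals are weakly connected components of the graph with edges $b\to f_i(b)$; isomorphisms preserve weights and operators. Tensor product: weights add; $e_i(b\otimes c)=b\otimes e_i(c)$ if $\varepsilon_i(b)\le\varphi_i(c)$ else $e_i(b)\otimes c$; $f_i(b\otimes c)=b\otimes f_i(c)$ if $\varepsilon_i(b)<\varphi_i(c)$ else $f_i(b)\otimes c$; $b\otimes0=0\otimes c=0$. $\mathbb{1}_n$: one element, weight $0$,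 zero operators. $\mathsf{SS}_n$: nonempty $S\subseteq[n]$, $\mathrm{wt}(S)=\sum_{j\in S}\mathbf{e}_j$, $e_i(S)=S\cup\{i\}$ if $S\cap\{i,i+1\}=\{i+1\}$, $S\setminus\{i+1\}$ if $S\cap\{i,i+1\}=\{i,i+1\}$, else $0$; $f_i(S)=S\cup\{i+1\}$ if $S\cap\{i,i+1\}=\{i\}$, $S\setminus\{i\}$ if $S\cap\{i,i+1\}=\{i,i+1\}$, else $0$. Normal: every full subcrystal is isomorphic to a full subcrystal of $\mathsf{SS}_n^{\otimes m}$ for some $m\ge0$ ($\mathsf{SS}_n^{\otimes0}=\mathbb{1}_n$). For $i\in[n-1]$ let $E_i(b)=e_i^{\varepsilon_i(b)}(b)$, and let $\mathsf{rect}=(E_1E_2\cdots E_{n-1})\cdots(E_1E_2E_3)(E_1E_2)(E_1)$, a composition of maps $\mathcal{B}\to\mathcal{B}$ (rightmost applied first). -}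

module Defs where

open import Data.Nat as ℕ using (ℕ; zero; suc; _≤_; _<_; _≤?_; _<?_)
open import Data.Integer as ℤ using (ℤ; +_; _-_; 0ℤ; 1ℤ)
open import Data.Bool using (Bool; true; false; if_then_else_; T; _∨_)
open import Data.Fin as Fin using (Fin; zero; suc; inject₁)
open import Data.Vec using (Vec; []; _∷_; lookup)
open import Data.List using (List; []; _∷_; take; allFin)
open import Data.Maybe using (Maybe; just; nothing; _>>=_)
import Data.Maybe as Maybe
open import Data.Product using (Σ; _×_; _,_; proj₁)
open import Data.Unit using (⊤; tt)
open import Function using (_∘_)
open import Function.Bundles using (_⇔_)
open import Relation.Binary.PropositionalEquality using (_≡_; _≢_; refl)
open import Relation.Nullary.Decidable using (⌊_⌋)

-- Conventions: n = suc m; weights are functions Fin (suc m) → ℤ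
-- (coordinate j ↔ index j+1 of the paper); operator index i : Fin m
-- stands for the paper's i+1 ∈ [n-1], with "i" ↦ inject₁ i and
-- "i+1" ↦ suc i.  The value 0 of the paper is `nothing`.

Wt : ℕ → Set
Wt m = Fin (suc m) → ℤ

_≗w_ : ∀ {m} → Wt m → Wt m → Set
u ≗w v = ∀ j → u j ≡ v j

_+w_ : ∀ {m} → Wt m → Wt m → Wt m
(u +w v) j = u j ℤ.+ v j

𝐞 : ∀ {m} → Fin (suc m) → Wt m
𝐞 k j = if ⌊ k Fin.≟ j ⌋ then 1ℤ else 0ℤ

iter : {A : Set} → ℕ → (A → Maybe A) → A → Maybe A
iter zero    g a = just a
iter (suc k) g a = iter k g a >>= g

-- apply g exactly k times, stopping early if 0 is reached
-- (only used with k = ε_i(b), where e_i^k(b) ≠ 0, so it is e_i^k(b))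
run : {A : Set} → ℕ → (A → Maybe A) → A → A
run zero    g a = a
run (suc k) g a with g a
... | just a′ = run k g a′
... | nothing = a

even? : ℕ → Bool
even? zero          = true
even? (suc zero)    = false
even? (suc (suc k)) = even? k

record Struct (m : ℕ) : Set₁ where
  field
    Carrier : Set
    wt      : Carrier → Wt m
    e f     : Fin m → Carrier → Maybe Carrier

record Crystal (m : ℕ) : Set₁ where
  field
    struct : Struct m
  open Struct struct public
  field
    ε φ     : Fin m → Carrier → ℕ
    ε-sup   : ∀ i b k → (k ≤ ε i b) ⇔ (iter k (e i) b ≢ nothing)
    φ-sup   : ∀ i b k → (k ≤ φ i b) ⇔ (iter k (f i) b ≢ nothing)
    axiom-a : ∀ i b → (+ φ i b) - (+ ε i b)
                        ≡ ℤ.+ 2 ℤ.* (wt b (inject₁ i) - wt b (suc i))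
    axiom-b : ∀ i b c → (e i b ≡ just c) ⇔ (f i c ≡ just b)
    axiom-b-wt : ∀ i b c → e i b ≡ just c →
                 if even? (ε i b)
                   then wt c ≗w (wt b +w 𝐞 (inject₁ i))
                   else (wt c +w 𝐞 (suc i)) ≗w wt b

HighestWeight : ∀ {m} (B : Crystal m) → Crystal.Carrier B → Set
HighestWeight {m} B b = ∀ (i : Fin m) → Crystal.e B i b ≡ nothing

-- Full subcrystals: weakly connected components of the graph b → f_i(b).

data Conn {m} (S : Struct m) : Struct.Carrier S → Struct.Carrier S → Set where
  here : ∀ {x} → Conn S x x
  fwd  : ∀ {x y z} (i : Fin m) → Struct.f S i x ≡ just y → Conn S y z → Conn S x z
  bwd  : ∀ {x y z} (i : Fin m) → Struct.f S i y ≡ just x → Conn S y z → Conn S x z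

-- An isomorphism between the full subcrystal of S containing b and the
-- full subcrystal of S′ containing b′ (elements of a component are given
-- by an element together with a connection proof; maps must not depend
-- on the proof).
record CompIso {m} (S : Struct m) (b : Struct.Carrier S)
                   (S′ : Struct m) (b′ : Struct.Carrier S′) : Set where
  module S = Struct S
  module S′ = Struct S′
  field
    to       : ∀ x → Conn S b x → S′.Carrier
    to-conn  : ∀ x p → Conn S′ b′ (to x p)
    to-irr   : ∀ x p q → to x p ≡ to x q
    from     : ∀ y → Conn S′ b′ y → S.Carrier
    from-conn : ∀ y q → Conn S b (from y q)
    from-irr : ∀ y q r → from y q ≡ from y r
    from-to  : ∀ x p → from (to x p) (to-conn x p) ≡ x
    to-from  : ∀ y q → to (from y q) (from-conn y q) ≡ y
    pres-wt  : ∀ x p → S′.wt (to x p) ≗w S.wt x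
    pres-e-0 : ∀ i x p → S.e i x ≡ nothing → S′.e i (to x p) ≡ nothing
    pres-e   : ∀ i x p x′ p′ → S.e i x ≡ just x′ → S′.e i (to x p) ≡ just (to x′ p′)
    pres-f-0 : ∀ i x p → S.f i x ≡ nothing → S′.f i (to x p) ≡ nothing
    pres-f   : ∀ i x p x′ p′ → S.f i x ≡ just x′ → S′.f i (to x p) ≡ just (to x′ p′)

-- Concrete crystals 𝟙_n, SS_n and tensor products.
-- `bound` is an upper bound for all ε_i, φ_i, so that the suprema
-- ε_i, φ_i can be computed by bounded search (`count`).
-- (In SS_n^{⊗k}, wt_i - wt_{i+1} ∈ [-k,k] moves by 1 at each e_i/f_i
-- step, so 2k is such a bound.)

record Fueled (m : ℕ) : Set₁ where
  field
    struct : Struct m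
    bound  : ℕ
  open Struct struct public

count : {A : Set} → ℕ → (A → Maybe A) → A → ℕ
count zero    g a = zero
count (suc N) g a with g a
... | just a′ = suc (count N g a′)
... | nothing = zero

module _ {m} (F : Fueled m) where
  open Fueled F
  εF φF : Fin m → Carrier → ℕ
  εF i b = count bound (e i) b
  φF i b = count bound (f i) b

𝟙 : ∀ m → Fueled m
𝟙 m = record
  { struct = record { Carrier = ⊤ ; wt = λ _ _ → 0ℤ
                    ; e = λ _ _ → nothing ; f = λ _ _ → nothing }
  ; bound = 0 }

-- nonempty subsets of [n] as bit vectors
anyB : ∀ {k} → Vec Bool k → Bool
anyB []       = false
anyB (x ∷ xs) = x ∨ anyB xs

pair2 : ∀ {m} → Fin m → Vec Bool (suc m) → Bool × Bool
pair2 zero    (x ∷ y ∷ v) = x , y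
pair2 (suc i) (x ∷ v)     = pair2 i v

upd : ∀ {m} → Fin m → Bool → Bool → Vec Bool (suc m) → Vec Bool (suc m)
upd zero    a b (x ∷ y ∷ v) = a ∷ b ∷ v
upd (suc i) a b (x ∷ v)     = x ∷ upd i a b v

∨-T : ∀ x {y} → T y → T (x ∨ y)
∨-T true  _ = tt
∨-T false t = t

upd-a : ∀ {m} (i : Fin m) b v → T (anyB (upd i true b v))
upd-a zero    b (x ∷ y ∷ v) = tt
upd-a (suc i) b (x ∷ v)     = ∨-T x (upd-a i b v)

upd-b : ∀ {m} (i : Fin m) a v → T (anyB (upd i a true v))
upd-b zero    true  (x ∷ y ∷ v) = tt
upd-b zero    false (x ∷ y ∷ v) = tt
upd-b (suc i) a (x ∷ v)         = ∨-T x (upd-b i a v)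

SSCarrier : ℕ → Set
SSCarrier m = Σ (Vec Bool (suc m)) (λ v → T (anyB v))

SSe : ∀ {m} → Fin m → SSCarrier m → Maybe (SSCarrier m)
SSe i (v , _) with pair2 i v
... | false , true = just (upd i true true v , upd-a i true v)    -- S ∪ {i}
... | true  , true = just (upd i true false v , upd-a i false v)  -- S ∖ {i+1}
... | _ = nothing

SSf : ∀ {m} → Fin m → SSCarrier m → Maybe (SSCarrier m)
SSf i (v , _) with pair2 i v
... | true , false = just (upd i true true v , upd-a i true v)    -- S ∪ {i+1}
... | true , true  = just (upd i false true v , upd-b i false v)  -- S ∖ {i}
... | _ = nothing

SS : ∀ m → Fueled m
SS m = record
  { struct = record
      { Carrier = SSCarrier m
      ; wt = λ S j → if lookup (proj₁ S) j then 1ℤ else 0ℤ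
      ; e = SSe ; f = SSf }
  ; bound = 2 }

_⊗_ : ∀ {m} → Fueled m → Fueled m → Fueled m
_⊗_ {m} B C = record
  { struct = record
      { Carrier = B.Carrier × C.Carrier
      ; wt = λ { (b , c) → B.wt b +w C.wt c }
      ; e = λ { i (b , c) → if ⌊ εF B i b ≤? φF C i c ⌋
                               then Maybe.map (b ,_) (C.e i c)
                               else Maybe.map (_, c) (B.e i b) }
      ; f = λ { i (b , c) → if ⌊ εF B i b <? φF C i c ⌋
                               then Maybe.map (b ,_) (C.f i c)
                               else Maybe.map (_, c) (B.f i b) } }
  ; bound = B.bound ℕ.+ C.bound }
  where module B = Fueled B
        module C = Fueled C

SSpow : ∀ m → ℕ → Fueled m
SSpow m zero          = 𝟙 m
SSpow m (suc zero)    = SS m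
SSpow m (suc (suc k)) = SSpow m (suc k) ⊗ SS m

Normal : ∀ {m} → Crystal m → Set
Normal {m} B = ∀ (b : Crystal.Carrier B) →
  Σ ℕ λ k → Σ (Fueled.Carrier (SSpow m k)) λ d →
    CompIso (Crystal.struct B) b (Fueled.struct (SSpow m k)) d

module _ {m} (B : Crystal m) where
  open Crystal B

  E : Fin m → Carrier → Carrier
  E i b = run (ε i b) (e i) b

  Eseq : List (Fin m) → Carrier → Carrier
  Eseq []       b = b
  Eseq (i ∷ is) b = E i (Eseq is b)

  -- (E_1 ⋯ E_k) ⋯ (E_1 E_2)(E_1)
  rectUpTo : ℕ → Carrier → Carrier
  rectUpTo zero    b = b
  rectUpTo (suc k) b = Eseq (take (suc k) (allFin m)) (rectUpTo k b)

  rect : Carrier → Carrier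
  rect = rectUpTo m

-- Every full subcrystal of a normal crystal is a component of some SSₙ^⊗k; flattening the
-- tensor power makes its elements words of columns, on which each e_i acts by the bracketing
-- (signature) rule and E_i acts letter by letter. Three local facts hold on words, hence in
-- every normal crystal: E_i kills e_i; for |i − j| ≥ 2, E_j changes no letter's i-signature,
-- so it keeps e_i dead; and if e_i w = 0 then e_{i+1} E_i E_{i+1} w = 0. The last one only
-- involves the rows i, i+1, i+2 of the columns and follows from an invariant (Slack) carried
-- through the word letter by letter. In rect, the block E_1 ⋯ E_k is applied to an element
-- killed by e_1, …, e_{k−1}: applying E_k, E_{k−1}, …, E_1 in turn, each E_j kills e_j, leaves
-- e_i dead for |i − j| ≥ 2, and kills e_{j+1} again by the third fact, so at the end
-- e_1, …, e_k are all dead.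

module Submission where

open import Defs
open import Data.Bool using (Bool; true; false; if_then_else_)
open import Data.Empty using (⊥-elim)
open import Data.Fin using (Fin; zero; suc; toℕ)
open import Data.Fin.Properties using (toℕ-injective; toℕ<n)
open import Data.List using (List; []; _∷_; _++_; [_]; take; tabulate)
import Data.List as List
open import Data.Maybe using (Maybe; just; nothing; _>>=_)
import Data.Maybe as Maybe
open import Data.Maybe.Properties using (map-∘; map-cong; map-id; map-nothing)
open import Data.Nat using (ℕ; zero; suc; _+_; _*_; _∸_; _≤_; _<_; _≤?_; z≤n; s≤s; ⌈_/2⌉)
open import Data.Nat.Properties
open import Data.Product using (Σ; _×_; _,_; proj₁; proj₂; uncurry′)
open import Data.Sum using (_⊎_; inj₁; inj₂)
open import Data.Vec using (Vec; _∷_)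
open import Function using (_∘_)
open import Function.Bundles using (_⇔_; mk⇔; Equivalence)
open import Relation.Binary using (tri<; tri≈; tri>)
open import Relation.Binary.PropositionalEquality hiding ([_])
open import Relation.Nullary using (yes; no)
open import Relation.Nullary.Decidable using (⌊_⌋)

open Equivalence using (to; from)

-- Iterating partial maps

just≢nothing : ∀ {A : Set} {x : A} → just x ≢ nothing
just≢nothing ()

map≡nothing⇒≡nothing : ∀ {A B : Set} {f : A → B} {mx} → Maybe.map f mx ≡ nothing → mx ≡ nothing
map≡nothing⇒≡nothing {mx = nothing} _ = refl

iter-suc : ∀ {A : Set} k (g : A → Maybe A) a → iter (suc k) g a ≡ (g a >>= iter k g)
iter-suc zero g a with g a
... | just _  = refl
... | nothing = refl
iter-suc (suc k) g a rewrite iter-suc k g a with g a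
... | just _  = refl
... | nothing = refl

run-iter : ∀ {A : Set} k (g : A → Maybe A) {a b} → iter k g a ≡ just b → run k g a ≡ b
run-iter zero    g refl = refl
run-iter (suc k) g {a} eq rewrite iter-suc k g a with g a
run-iter (suc k) g eq | just a′ = run-iter k g eq
run-iter (suc k) g () | nothing

StringLength : {A : Set} → (A → Maybe A) → A → ℕ → Set
StringLength g a n = ∀ k → (k ≤ n) ⇔ (iter k g a ≢ nothing)

module _ {A : Set} {g : A → Maybe A} {a : A} where

  StringLength-unique : ∀ {m n} → StringLength g a m → StringLength g a n → m ≡ n
  StringLength-unique sm sn =
    ≤-antisym (from (sn _) (to (sm _) ≤-refl)) (from (sm _) (to (sn _) ≤-refl))

  run-StringLength : ∀ {n} → StringLength g a n → g (run n g a) ≡ nothing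
  run-StringLength {n} sl with iter n g a in eq
  ... | nothing = ⊥-elim (to (sl n) ≤-refl eq)
  ... | just b rewrite run-iter n g eq with g b in eq′
  ...   | nothing = refl
  ...   | just _  = ⊥-elim (1+n≰n (from (sl (suc n)) λ q →
                      just≢nothing (trans (sym (trans (cong (_>>= g) eq) eq′)) q)))

module _ {A B : Set} {g : A → Maybe A} {g′ : B → Maybe B} (h : A → B)
         (commute : ∀ a → g′ (h a) ≡ Maybe.map h (g a)) where

  iter-commute : ∀ k a → iter k g′ (h a) ≡ Maybe.map h (iter k g a)
  iter-commute zero    a = refl
  iter-commute (suc k) a rewrite iter-commute k a with iter k g a
  ... | nothing = refl
  ... | just a′ = commute a′

  run-commute : ∀ k a → run k g′ (h a) ≡ h (run k g a)
  run-commute zero    a = refl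
  run-commute (suc k) a rewrite commute a with g a
  ... | nothing = refl
  ... | just a′ = run-commute k a′

  count-commute : ∀ N a → count N g′ (h a) ≡ count N g a
  count-commute zero    a = refl
  count-commute (suc N) a rewrite commute a with g a
  ... | nothing = refl
  ... | just a′ = cong suc (count-commute N a′)

  iter≡nothing-commute : ∀ k a → (iter k g′ (h a) ≡ nothing) ⇔ (iter k g a ≡ nothing)
  iter≡nothing-commute k a =
    mk⇔ (map≡nothing⇒≡nothing ∘ trans (sym (iter-commute k a)))
        (trans (iter-commute k a) ∘ map-nothing)

  StringLength-commute : ∀ {a n} → StringLength g′ (h a) n ⇔ StringLength g a n
  StringLength-commute {a} = mk⇔
    (λ sl k → mk⇔ (λ k≤n → to (sl k) k≤n ∘ from (iter≡nothing-commute k a))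
                  (λ ne → from (sl k) (ne ∘ to (iter≡nothing-commute k a))))
    (λ sl k → mk⇔ (λ k≤n → to (sl k) k≤n ∘ to (iter≡nothing-commute k a))
                  (λ ne → from (sl k) (ne ∘ from (iter≡nothing-commute k a))))

module Decreasing {A : Set} (g : A → Maybe A) (len : A → ℕ)
  (len-nothing : ∀ {a} → g a ≡ nothing → len a ≡ 0)
  (len-just : ∀ {a a′} → g a ≡ just a′ → len a ≡ suc (len a′)) where

  len≡0⇒nothing : ∀ {a} → len a ≡ 0 → g a ≡ nothing
  len≡0⇒nothing {a} eq with g a in ga
  ... | nothing = refl
  ... | just _  = ⊥-elim (0≢1+n (trans (sym eq) (len-just ga)))

  ≤len⇒iter≢nothing : ∀ k a → k ≤ len a → iter k g a ≢ nothing
  ≤len⇒iter≢nothing zero    a _ ()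
  ≤len⇒iter≢nothing (suc k) a k<len rewrite iter-suc k g a with g a in ga
  ... | nothing = ⊥-elim (<⇒≱ (subst (suc k ≤_) (len-nothing ga) k<len) z≤n)
  ... | just a′ = ≤len⇒iter≢nothing k a′ (≤-pred (subst (suc k ≤_) (len-just ga) k<len))

  iter≢nothing⇒≤len : ∀ k a → iter k g a ≢ nothing → k ≤ len a
  iter≢nothing⇒≤len zero    a _  = z≤n
  iter≢nothing⇒≤len (suc k) a ne rewrite iter-suc k g a with g a in ga
  ... | nothing = ⊥-elim (ne refl)
  ... | just a′ = subst (suc k ≤_) (sym (len-just ga)) (s≤s (iter≢nothing⇒≤len k a′ ne))

  string-length : ∀ a → StringLength g a (len a)
  string-length a k = mk⇔ (≤len⇒iter≢nothing k a) (iter≢nothing⇒≤len k a)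

  count-len : ∀ N a → len a ≤ N → count N g a ≡ len a
  count-len zero    a le = sym (n≤0⇒n≡0 le)
  count-len (suc N) a le with g a in ga
  ... | nothing = sym (len-nothing ga)
  ... | just a′ = trans (cong suc (count-len N a′ (≤-pred (subst (_≤ suc N) (len-just ga) le))))
                        (sym (len-just ga))

-- The signature rule on words

[m∸o]+[n∸[p+[o∸m]]]≡[m+[n∸p]]∸o : ∀ m n o p →
                                  (m ∸ o) + (n ∸ (p + (o ∸ m))) ≡ (m + (n ∸ p)) ∸ o
[m∸o]+[n∸[p+[o∸m]]]≡[m+[n∸p]]∸o m n o p with ≤-total o m
... | inj₁ o≤m rewrite m≤n⇒m∸n≡0 o≤m | +-identityʳ p = sym (+-∸-comm (n ∸ p) o≤m)
... | inj₂ m≤o = begin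
  (m ∸ o) + (n ∸ (p + (o ∸ m)))  ≡⟨ cong (_+ (n ∸ (p + (o ∸ m)))) (m≤n⇒m∸n≡0 m≤o) ⟩
  n ∸ (p + (o ∸ m))              ≡⟨ ∸-+-assoc n p (o ∸ m) ⟨
  (n ∸ p) ∸ (o ∸ m)              ≡⟨ [m+n]∸[m+o]≡n∸o m (n ∸ p) (o ∸ m) ⟨
  (m + (n ∸ p)) ∸ (m + (o ∸ m))  ≡⟨ cong ((m + (n ∸ p)) ∸_) (m+[n∸m]≡n m≤o) ⟩
  (m + (n ∸ p)) ∸ o              ∎
  where open ≡-Reasoning

m+[n∸p]≤o⇒n≤p+[o∸m] : ∀ m n o p → m + (n ∸ p) ≤ o → n ≤ p + (o ∸ m)
m+[n∸p]≤o⇒n≤p+[o∸m] m n o p le =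
  ≤-trans (m≤n+m∸n n p)
          (+-monoʳ-≤ p (m+n≤o⇒m≤o∸n (n ∸ p) (subst (_≤ o) (+-comm m (n ∸ p)) le)))

o<m+[n∸p]⇒p<n⇒p+[o∸m]<n : ∀ m n o p → o < m + (n ∸ p) → p < n → p + (o ∸ m) < n
o<m+[n∸p]⇒p<n⇒p+[o∸m]<n m n o p o< p<n with ≤-total o m
... | inj₁ o≤m rewrite m≤n⇒m∸n≡0 o≤m | +-identityʳ p = p<n
... | inj₂ m≤o = subst (p + (o ∸ m) <_) (m+[n∸m]≡n (<⇒≤ p<n))
  (+-monoʳ-< p (+-cancelˡ-< m (o ∸ m) (n ∸ p) (subst (_< m + (n ∸ p)) (sym (m+[n∸m]≡n m≤o)) o<)))

-- A word c ∷ w stands for c ⊗ w, so eʷ is the tensor product rule of Defs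
-- and εʷ, φʷ are the resulting bracket counts of the signature rule.
module Signature {L : Set} (ε φ : L → ℕ) (e : L → Maybe L) where

  εʷ φʷ : List L → ℕ
  εʷ []      = 0
  εʷ (c ∷ w) = εʷ w + (ε c ∸ φʷ w)
  φʷ []      = 0
  φʷ (c ∷ w) = φ c + (φʷ w ∸ ε c)

  eʷ : List L → Maybe (List L)
  eʷ []      = nothing
  eʷ (c ∷ w) = if ⌊ ε c ≤? φʷ w ⌋ then Maybe.map (c ∷_) (eʷ w) else Maybe.map (_∷ w) (e c)

  -- E on words acts letter by letter: of the e-steps applied to c ⊗ w,
  -- exactly ε c ∸ φʷ w reach c (run-εʷ).
  Eʷ : List L → List L
  Eʷ []      = []
  Eʷ (c ∷ w) = run (ε c ∸ φʷ w) e c ∷ Eʷ w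

  φʷ-[_] : ∀ c → φʷ [ c ] ≡ φ c
  φʷ-[ c ] = trans (cong (φ c +_) (0∸n≡0 (ε c))) (+-identityʳ (φ c))

  φʷ-++ : ∀ u v → φʷ (u ++ v) ≡ φʷ u + (φʷ v ∸ εʷ u)
  φʷ-++ []      v = refl
  φʷ-++ (c ∷ u) v rewrite φʷ-++ u v =
    trans (cong (φ c +_) (sym ([m∸o]+[n∸[p+[o∸m]]]≡[m+[n∸p]]∸o (φʷ u) (φʷ v) (ε c) (εʷ u))))
          (sym (+-assoc (φ c) _ _))

  εʷ-++ : ∀ u v → εʷ (u ++ v) ≡ εʷ v + (εʷ u ∸ φʷ v)
  εʷ-++ []      v = sym (trans (cong (εʷ v +_) (0∸n≡0 (φʷ v))) (+-identityʳ (εʷ v)))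
  εʷ-++ (c ∷ u) v rewrite εʷ-++ u v | φʷ-++ u v =
    trans (+-assoc (εʷ v) _ _)
          (cong (εʷ v +_) ([m∸o]+[n∸[p+[o∸m]]]≡[m+[n∸p]]∸o (εʷ u) (ε c) (φʷ v) (φʷ u)))

  eʷ-++ : ∀ u v → eʷ (u ++ v) ≡ (if ⌊ εʷ u ≤? φʷ v ⌋ then Maybe.map (u ++_) (eʷ v)
                                                       else Maybe.map (_++ v) (eʷ u))
  eʷ-++ []      v = sym (map-id (eʷ v))
  eʷ-++ (c ∷ u) v rewrite φʷ-++ u v | eʷ-++ u v with εʷ (c ∷ u) ≤? φʷ v
  ... | yes cu≤ with ε c ≤? φʷ u + (φʷ v ∸ εʷ u) | εʷ u ≤? φʷ v
  ...   | yes _  | yes _  = sym (map-∘ (eʷ v))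
  ...   | no c≰  | _      =
    ⊥-elim (c≰ (m+[n∸p]≤o⇒n≤p+[o∸m] (εʷ u) (ε c) (φʷ v) (φʷ u) cu≤))
  ...   | yes _  | no u≰  = ⊥-elim (u≰ (m+n≤o⇒m≤o (εʷ u) cu≤))
  eʷ-++ (c ∷ u) v | no cu≰ with ε c ≤? φʷ u
  ... | yes c≤ with ε c ≤? φʷ u + (φʷ v ∸ εʷ u) | εʷ u ≤? φʷ v
  ...   | yes _ | no _  = trans (sym (map-∘ (eʷ u))) (map-∘ (eʷ u))
  ...   | no c≰ | _     = ⊥-elim (c≰ (≤-trans c≤ (m≤m+n (φʷ u) _)))
  ...   | yes _ | yes u≤ =
    ⊥-elim (cu≰ (subst (_≤ φʷ v) (sym (trans (cong (εʷ u +_) (m≤n⇒m∸n≡0 c≤)) (+-identityʳ _))) u≤))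
  eʷ-++ (c ∷ u) v | no cu≰ | no c≰ with ε c ≤? φʷ u + (φʷ v ∸ εʷ u)
  ... | no _   = map-∘ (e c)
  ... | yes c≤ =
    ⊥-elim (<⇒≱ (o<m+[n∸p]⇒p<n⇒p+[o∸m]<n (εʷ u) (ε c) (φʷ v) (φʷ u) (≰⇒> cu≰) (≰⇒> c≰)) c≤)

  module Seminormal
    (ε-nothing : ∀ {c} → e c ≡ nothing → ε c ≡ 0)
    (ε-just : ∀ {c c′} → e c ≡ just c′ → ε c ≡ suc (ε c′))
    (φ-just : ∀ {c c′} → e c ≡ just c′ → φ c′ ≡ suc (φ c)) where

    open Decreasing e ε ε-nothing ε-just using () renaming (len≡0⇒nothing to ε≡0⇒e≡nothing)

    eʷ-just : ∀ {w w′} → eʷ w ≡ just w′ → εʷ w ≡ suc (εʷ w′) × φʷ w′ ≡ suc (φʷ w)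
    eʷ-just {c ∷ w} eq with ε c ≤? φʷ w | eʷ w in ew | e c in ec
    eʷ-just {c ∷ w} refl | yes c≤ | just w′ | _ with eʷ-just {w} ew
    ... | εw≡ , φw′≡
      rewrite εw≡ | φw′≡ | m≤n⇒m∸n≡0 c≤ | m≤n⇒m∸n≡0 (m≤n⇒m≤1+n c≤) | +-∸-assoc 1 c≤ =
      refl , +-suc (φ c) _
    eʷ-just {c ∷ w} refl | no c≰ | _ | just c′ with ≤-pred (subst (φʷ w <_) (ε-just ec) (≰⇒> c≰))
    ... | φw≤
      rewrite ε-just ec | φ-just ec | +-∸-assoc 1 φw≤ | m≤n⇒m∸n≡0 φw≤ | m≤n⇒m∸n≡0 (m≤n⇒m≤1+n φw≤) =
      +-suc (εʷ w) _ , refl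
    eʷ-just {c ∷ w} () | yes _ | nothing | _
    eʷ-just {c ∷ w} () | no _  | _       | nothing

    εʷ-nothing : ∀ {w} → eʷ w ≡ nothing → εʷ w ≡ 0
    εʷ-nothing {[]} _ = refl
    εʷ-nothing {c ∷ w} eq with ε c ≤? φʷ w | eʷ w in ew | e c in ec
    ... | yes c≤ | nothing | _       rewrite εʷ-nothing {w} ew = m≤n⇒m∸n≡0 c≤
    ... | no c≰  | _       | nothing = ⊥-elim (c≰ (subst (_≤ φʷ w) (sym (ε-nothing ec)) z≤n))
    εʷ-nothing {c ∷ w} () | yes _ | just _ | _
    εʷ-nothing {c ∷ w} () | no _  | _      | just _

    open Decreasing eʷ εʷ (λ {w} → εʷ-nothing {w}) (λ {w} → proj₁ ∘ eʷ-just {w}) public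
      using (string-length; count-len) renaming (len≡0⇒nothing to εʷ≡0⇒eʷ≡nothing)

    eʷ-[_] : ∀ c → eʷ [ c ] ≡ Maybe.map [_] (e c)
    eʷ-[ c ] with ε c ≤? 0
    ... | yes c≤0 rewrite ε≡0⇒e≡nothing (n≤0⇒n≡0 c≤0) = refl
    ... | no _    = refl

    run-skip : ∀ {c} k w → ε c ≤ φʷ w → run k eʷ (c ∷ w) ≡ c ∷ run k eʷ w
    run-skip zero        w _  = refl
    run-skip {c} (suc k) w c≤ with ε c ≤? φʷ w
    ... | no c≰ = ⊥-elim (c≰ c≤)
    ... | yes _ with eʷ w in ew
    ...   | nothing = refl
    ...   | just w′ =
      run-skip k w′ (≤-trans c≤ (≤-trans (n≤1+n _) (≤-reflexive (sym (proj₂ (eʷ-just {w} ew))))))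

    run-cons : ∀ {c} t k w → ε c ∸ φʷ w ≡ t →
               run (t + k) eʷ (c ∷ w) ≡ run t e c ∷ run k eʷ w
    run-cons zero        k w eq = run-skip k w (m∸n≡0⇒m≤n eq)
    run-cons {c} (suc t) k w eq with ε c ≤? φʷ w
    ... | yes c≤ = ⊥-elim (0≢1+n (trans (sym (m≤n⇒m∸n≡0 c≤)) eq))
    ... | no c≰ with e c in ec
    ...   | nothing = ⊥-elim (c≰ (subst (_≤ φʷ w) (sym (ε-nothing ec)) z≤n))
    ...   | just c′ = run-cons t k w (suc-injective (begin
      suc (ε c′ ∸ φʷ w)  ≡⟨ +-∸-assoc 1 φw≤ ⟨
      suc (ε c′) ∸ φʷ w  ≡⟨ cong (_∸ φʷ w) (ε-just ec) ⟨
      ε c ∸ φʷ w         ≡⟨ eq ⟩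
      suc t              ∎))
      where open ≡-Reasoning
            φw≤ : φʷ w ≤ ε c′
            φw≤ = ≤-pred (subst (φʷ w <_) (ε-just ec) (≰⇒> c≰))

    run-εʷ : ∀ w → run (εʷ w) eʷ w ≡ Eʷ w
    run-εʷ []      = refl
    run-εʷ (c ∷ w) = begin
      run (εʷ w + t) eʷ (c ∷ w)    ≡⟨ cong (λ k → run k eʷ (c ∷ w)) (+-comm (εʷ w) t) ⟩
      run (t + εʷ w) eʷ (c ∷ w)    ≡⟨ run-cons t (εʷ w) w refl ⟩
      run t e c ∷ run (εʷ w) eʷ w  ≡⟨ cong (run t e c ∷_) (run-εʷ w) ⟩
      run t e c ∷ Eʷ w             ∎
      where open ≡-Reasoning
            t = ε c ∸ φʷ w

module SignatureMorphism {L L′ : Set} (ε φ : L → ℕ) (e : L → Maybe L)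
  (ε′ φ′ : L′ → ℕ) (e′ : L′ → Maybe L′) (h : L → L′)
  (ε-h : ∀ c → ε′ (h c) ≡ ε c) (φ-h : ∀ c → φ′ (h c) ≡ φ c)
  (e-h : ∀ c → e′ (h c) ≡ Maybe.map h (e c)) where

  private
    module W  = Signature ε φ e
    module W′ = Signature ε′ φ′ e′

  φʷ-map : ∀ w → W′.φʷ (List.map h w) ≡ W.φʷ w
  φʷ-map []      = refl
  φʷ-map (c ∷ w) rewrite φ-h c | ε-h c | φʷ-map w = refl

  εʷ-map : ∀ w → W′.εʷ (List.map h w) ≡ W.εʷ w
  εʷ-map []      = refl
  εʷ-map (c ∷ w) rewrite ε-h c | φʷ-map w | εʷ-map w = refl

  Eʷ-map : ∀ w → W′.Eʷ (List.map h w) ≡ List.map h (W.Eʷ w)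
  Eʷ-map []      = refl
  Eʷ-map (c ∷ w) rewrite ε-h c | φʷ-map w =
    cong₂ _∷_ (run-commute {g = e} {g′ = e′} h e-h (ε c ∸ W.φʷ w) c) (Eʷ-map w)

-- Columns of SSₙ, and tensor powers of SSₙ as words of columns

Bit² : Set
Bit² = Bool × Bool

εᵖ φᵖ : Bit² → ℕ
εᵖ (false , true)  = 2
εᵖ (true  , true)  = 1
εᵖ _               = 0
φᵖ (true  , false) = 2
φᵖ (true  , true)  = 1
φᵖ _               = 0

eᵖ : Bit² → Maybe Bit²
eᵖ (false , true) = just (true , true)
eᵖ (true  , true) = just (true , false)
eᵖ _              = nothing

pair2-upd : ∀ {m} (i : Fin m) a b v → pair2 i (upd i a b v) ≡ (a , b)
pair2-upd zero    a b (_ ∷ _ ∷ _) = refl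
pair2-upd (suc i) a b (_ ∷ v)     = pair2-upd i a b v

module _ {m : ℕ} where

  εˢ φˢ : Fin m → SSCarrier m → ℕ
  εˢ i (v , _) = εᵖ (pair2 i v)
  φˢ i (v , _) = φᵖ (pair2 i v)

  SSe-eᵖ : ∀ (i : Fin m) c → Maybe.map proj₁ (SSe i c)
                             ≡ Maybe.map (uncurry′ λ a b → upd i a b (proj₁ c)) (eᵖ (pair2 i (proj₁ c)))
  SSe-eᵖ i (v , _) with pair2 i v
  ... | false , false = refl
  ... | false , true  = refl
  ... | true  , false = refl
  ... | true  , true  = refl

  SSe≡nothing⇒εˢ≡0 : ∀ i {c} → SSe i c ≡ nothing → εˢ i c ≡ 0
  SSe≡nothing⇒εˢ≡0 i {v , _} eq with pair2 i v
  SSe≡nothing⇒εˢ≡0 i ()   | false , true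
  SSe≡nothing⇒εˢ≡0 i ()   | true  , true
  SSe≡nothing⇒εˢ≡0 i refl | false , false = refl
  SSe≡nothing⇒εˢ≡0 i refl | true  , false = refl

  SSe-just : ∀ i {c c′} → SSe i c ≡ just c′ →
             εˢ i c ≡ suc (εˢ i c′) × φˢ i c′ ≡ suc (φˢ i c)
  SSe-just i {v , _} eq with pair2 i v | pair2-upd i true true v | pair2-upd i true false v
  SSe-just i {v , _} refl | false , true  | p | _ rewrite p = refl , refl
  SSe-just i {v , _} refl | true  , true  | _ | p rewrite p = refl , refl
  SSe-just i {v , _} ()   | false , false | _ | _
  SSe-just i {v , _} ()   | true  , false | _ | _

  εˢ≤2 : ∀ i c → εˢ i c ≤ 2
  εˢ≤2 i (v , _) with pair2 i v
  ... | false , false = z≤n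
  ... | false , true  = ≤-refl
  ... | true  , false = z≤n
  ... | true  , true  = s≤s z≤n

  count-SSf : ∀ i c → count 2 (SSf i) c ≡ φˢ i c
  count-SSf i (v , _) with pair2 i v | pair2-upd i true true v | pair2-upd i false true v
  ... | false , false | _ | _ = refl
  ... | false , true  | _ | _ = refl
  ... | true  , false | p | _ rewrite p = refl
  ... | true  , true  | _ | p rewrite p = refl

module Columns {m : ℕ} (i : Fin m) where
  open Signature (εˢ i) (φˢ i) (SSe i) public
  open Seminormal (λ {c} → SSe≡nothing⇒εˢ≡0 i {c})
                  (λ {c} eq → proj₁ (SSe-just i {c} eq)) (λ {c} eq → proj₂ (SSe-just i {c} eq)) public

open Columns

Eʷs : ∀ {m} → List (Fin m) → List (SSCarrier m) → List (SSCarrier m)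
Eʷs []      w = w
Eʷs (i ∷ l) w = Eʷ i (Eʷs l w)

flatten : ∀ {m} k → Fueled.Carrier (SSpow m k) → List (SSCarrier m)
flatten zero          _       = []
flatten (suc zero)    c       = [ c ]
flatten (suc (suc k)) (b , c) = flatten (suc k) b ++ [ c ]

module _ {m : ℕ} (i : Fin m) where

  εʷ-snoc≤ : ∀ w c → εʷ i (w ++ [ c ]) ≤ εʷ i w + 2
  εʷ-snoc≤ w c rewrite εʷ-++ i w [ c ] | φʷ-[_] i c =
    subst (εˢ i c + (εʷ i w ∸ φˢ i c) ≤_) (+-comm 2 (εʷ i w))
          (+-mono-≤ (εˢ≤2 i c) (m∸n≤m (εʷ i w) (φˢ i c)))

  εʷ-flatten≤bound : ∀ k b → εʷ i (flatten k b) ≤ Fueled.bound (SSpow m k)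
  εʷ-flatten≤bound zero          _       = z≤n
  εʷ-flatten≤bound (suc zero)    c       = εˢ≤2 i c
  εʷ-flatten≤bound (suc (suc k)) (b , c) =
    ≤-trans (εʷ-snoc≤ (flatten (suc k) b) c) (+-monoˡ-≤ 2 (εʷ-flatten≤bound (suc k) b))

  FlattenCommutes : ℕ → Set
  FlattenCommutes k = ∀ b → eʷ i (flatten k b) ≡ Maybe.map (flatten k) (Fueled.e (SSpow m k) i b)

  εF-flatten : ∀ k → FlattenCommutes (suc k) →
               ∀ b → εF (SSpow m (suc k)) i b ≡ εʷ i (flatten (suc k) b)
  εF-flatten k e-flatten b = trans
    (sym (count-commute {g = Fueled.e Bₖ i} {g′ = eʷ i} (flatten (suc k)) e-flatten (Fueled.bound Bₖ) b))
    (count-len i (Fueled.bound Bₖ) (flatten (suc k) b) (εʷ-flatten≤bound (suc k) b))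
    where Bₖ = SSpow m (suc k)

  e-flatten-step : ∀ k → FlattenCommutes (suc k) → FlattenCommutes (suc (suc k))
  e-flatten-step k e-flatten (b , c)
    rewrite eʷ-++ i (flatten (suc k) b) [ c ] | φʷ-[_] i c | eʷ-[_] i c
          | εF-flatten k e-flatten b | count-SSf i c
    with εʷ i (flatten (suc k) b) ≤? φˢ i c
  ... | yes _ = trans (sym (map-∘ (SSe i c))) (map-∘ (SSe i c))
  ... | no _ rewrite e-flatten b =
    trans (sym (map-∘ (Fueled.e (SSpow m (suc k)) i b))) (map-∘ (Fueled.e (SSpow m (suc k)) i b))

  e-flatten : ∀ k → FlattenCommutes k
  e-flatten zero          _ = refl
  e-flatten (suc zero)    c = eʷ-[_] i c
  e-flatten (suc (suc k))   = e-flatten-step k (e-flatten (suc k))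

-- Normal crystals are locally word crystals

module LocalWordModel {m : ℕ} (B : Crystal m) where
  open Crystal B

  Component : Carrier → Set
  Component y = Σ Carrier (Conn struct y)

  Conn-extend : ∀ {y x x′} i → Conn struct y x → f i x′ ≡ just x → Conn struct y x′
  Conn-extend i here          q = bwd i q here
  Conn-extend i (fwd j p y→x) q = fwd j p (Conn-extend i y→x q)
  Conn-extend i (bwd j p y→x) q = bwd j p (Conn-extend i y→x q)

  -- The equation is the edge by which the path from y is extended.
  eᶜ-via : ∀ {y} i (c : Component y) mx → e i (proj₁ c) ≡ mx → Maybe (Component y)
  eᶜ-via i _         nothing   _  = nothing
  eᶜ-via i (x , y→x) (just x′) ex = just (x′ , Conn-extend i y→x (to (axiom-b i x x′) ex))

  eᶜ : ∀ {y} → Fin m → Component y → Maybe (Component y)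
  eᶜ i c = eᶜ-via i c (e i (proj₁ c)) refl

  e-proj₁ : ∀ {y} i (c : Component y) → e i (proj₁ c) ≡ Maybe.map proj₁ (eᶜ i c)
  e-proj₁ i c = via (e i (proj₁ c)) refl
    where via : ∀ mx (ex : e i (proj₁ c) ≡ mx) → mx ≡ Maybe.map proj₁ (eᶜ-via i c mx ex)
          via nothing  _ = refl
          via (just _) _ = refl

  module _ {y} k {d} (iso : CompIso struct y (Fueled.struct (SSpow m k)) d) where
    open CompIso iso using (pres-e; pres-e-0) renaming (to to iso-to)

    toWord : Component y → List (SSCarrier m)
    toWord (x , y→x) = flatten k (iso-to x y→x)

    eʷ-toWord : ∀ i c → eʷ i (toWord c) ≡ Maybe.map toWord (eᶜ i c)
    eʷ-toWord i (x , y→x) = trans (e-flatten i k (iso-to x y→x)) (via (e i x) refl)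
      where via : ∀ mx (ex : e i x ≡ mx) → Maybe.map (flatten k) (Fueled.e (SSpow m k) i (iso-to x y→x))
                                           ≡ Maybe.map toWord (eᶜ-via i (x , y→x) mx ex)
            via nothing   ex rewrite pres-e-0 i x y→x ex = refl
            via (just x′) ex
              rewrite pres-e i x y→x x′ (Conn-extend i y→x (to (axiom-b i x x′) ex)) ex = refl

    ε-toWord : ∀ i c → ε i (proj₁ c) ≡ εʷ i (toWord c)
    ε-toWord i c = StringLength-unique
      (from (StringLength-commute {g = eᶜ i} toWord (eʷ-toWord i))
            (to (StringLength-commute {g = eᶜ i} proj₁ (e-proj₁ i)) (ε-sup i (proj₁ c))))
      (string-length i (toWord c))

    E-toWord : ∀ i c → Σ (Component y) λ c′ →
               proj₁ c′ ≡ E B i (proj₁ c) × toWord c′ ≡ Eʷ i (toWord c)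
    E-toWord i c = run n (eᶜ i) c , sym (run-commute proj₁ (e-proj₁ i) n c) , (begin
      toWord (run n (eᶜ i) c)      ≡⟨ run-commute toWord (eʷ-toWord i) n c ⟨
      run n (eʷ i) (toWord c)      ≡⟨ cong (λ k → run k (eʷ i) (toWord c)) (ε-toWord i c) ⟩
      run (εʷ i (toWord c)) (eʷ i) (toWord c)  ≡⟨ run-εʷ i (toWord c) ⟩
      Eʷ i (toWord c)              ∎)
      where open ≡-Reasoning
            n = ε i (proj₁ c)

    Eseq-toWord : ∀ l c → Σ (Component y) λ c′ →
                  proj₁ c′ ≡ Eseq B l (proj₁ c) × toWord c′ ≡ Eʷs l (toWord c)
    Eseq-toWord []      c = c , refl , refl
    Eseq-toWord (i ∷ l) c with Eseq-toWord l c
    ... | c′ , x≡ , w≡ with E-toWord i c′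
    ...   | c″ , x′≡ , w′≡ = c″ , trans x′≡ (cong (E B i) x≡) , trans w′≡ (cong (Eʷ i) w≡)

    e≡nothing⇔eʷ≡nothing : ∀ i c → (e i (proj₁ c) ≡ nothing) ⇔ (eʷ i (toWord c) ≡ nothing)
    e≡nothing⇔eʷ≡nothing i c = mk⇔
      (λ eq → trans (eʷ-toWord i c)
                    (map-nothing (map≡nothing⇒≡nothing {f = proj₁} {eᶜ i c} (trans (sym (e-proj₁ i c)) eq))))
      (λ eq → trans (e-proj₁ i c)
                    (map-nothing (map≡nothing⇒≡nothing {f = toWord} {eᶜ i c} (trans (sym (eʷ-toWord i c)) eq))))

  word-model : Normal B → ∀ x → Σ (List (SSCarrier m)) λ w →
               ∀ l i → (e i (Eseq B l x) ≡ nothing) ⇔ (eʷ i (Eʷs l w) ≡ nothing)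
  word-model normal x with normal x
  ... | k , d , iso = toWord k iso (x , here) , λ l i →
    let (c , x≡ , w≡) = Eseq-toWord k iso l (x , here) in
    subst₂ (λ x′ w′ → (e i x′ ≡ nothing) ⇔ (eʷ i w′ ≡ nothing)) x≡ w≡
           (e≡nothing⇔eʷ≡nothing k iso i c)

-- Operators with far-apart indices

Far : ∀ {m} → Fin m → Fin m → Set
Far i j = suc (toℕ i) < toℕ j ⊎ suc (toℕ j) < toℕ i

pair2-upd-far : ∀ {m} (i j : Fin m) a b v → Far i j → pair2 i (upd j a b v) ≡ pair2 i v
pair2-upd-far zero          zero          a b v           (inj₁ ())
pair2-upd-far zero          zero          a b v           (inj₂ ())
pair2-upd-far zero          (suc zero)    a b v           (inj₁ (s≤s ()))
pair2-upd-far zero          (suc zero)    a b v           (inj₂ ())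
pair2-upd-far zero          (suc (suc j)) a b (_ ∷ _ ∷ v) _ = refl
pair2-upd-far (suc zero)    zero          a b v           (inj₁ ())
pair2-upd-far (suc zero)    zero          a b v           (inj₂ (s≤s ()))
pair2-upd-far (suc (suc i)) zero          a b (_ ∷ _ ∷ v) _ = refl
pair2-upd-far (suc i)       (suc j)       a b (_ ∷ v)     (inj₁ (s≤s far)) =
  pair2-upd-far i j a b v (inj₁ far)
pair2-upd-far (suc i)       (suc j)       a b (_ ∷ v)     (inj₂ (s≤s far)) =
  pair2-upd-far i j a b v (inj₂ far)

module _ {m} {i j : Fin m} (far : Far i j) where

  pair2-SSe-far : ∀ {c c′} → SSe j c ≡ just c′ → pair2 i (proj₁ c′) ≡ pair2 i (proj₁ c)
  pair2-SSe-far {v , _} eq with pair2 j v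
  pair2-SSe-far {v , _} refl | false , true  = pair2-upd-far i j true true v far
  pair2-SSe-far {v , _} refl | true  , true  = pair2-upd-far i j true false v far
  pair2-SSe-far {v , _} ()   | false , false
  pair2-SSe-far {v , _} ()   | true  , false

  pair2-run-far : ∀ k c → pair2 i (proj₁ (run k (SSe j) c)) ≡ pair2 i (proj₁ c)
  pair2-run-far zero    c = refl
  pair2-run-far (suc k) c with SSe j c in eq
  ... | nothing = refl
  ... | just c′ = trans (pair2-run-far k c′) (pair2-SSe-far {c} eq)

  εφʷ-Eʷ-far : ∀ w → εʷ i (Eʷ j w) ≡ εʷ i w × φʷ i (Eʷ j w) ≡ φʷ i w
  εφʷ-Eʷ-far []      = refl , refl
  εφʷ-Eʷ-far (c ∷ w) with εφʷ-Eʷ-far w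
  ... | ε≡ , φ≡ rewrite ε≡ | φ≡ | pair2-run-far (εˢ j c ∸ φʷ j w) c = refl , refl

  eʷ-Eʷ-far : ∀ w → eʷ i w ≡ nothing → eʷ i (Eʷ j w) ≡ nothing
  eʷ-Eʷ-far w eq =
    εʷ≡0⇒eʷ≡nothing i {Eʷ j w} (trans (proj₁ (εφʷ-Eʷ-far w)) (εʷ-nothing i {w} eq))

-- Adjacent operators, read on the rows i, i + 1, i + 2 of the columns

Bit³ : Set
Bit³ = Bool × Bool × Bool

lower upper : Bit³ → Bit²
lower (x , y , _) = x , y
upper (_ , y , z) = y , z

ε₁ φ₁ ε₂ φ₂ : Bit³ → ℕ
ε₁ = εᵖ ∘ lower
φ₁ = φᵖ ∘ lower
ε₂ = εᵖ ∘ upper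
φ₂ = φᵖ ∘ upper

e₁ e₂ : Bit³ → Maybe Bit³
e₁ (x , y , z) = Maybe.map (uncurry′ λ x′ y′ → x′ , y′ , z) (eᵖ (x , y))
e₂ (x , y , z) = Maybe.map (uncurry′ λ y′ z′ → x , y′ , z′) (eᵖ (y , z))

data Adjacent : ∀ {m} → Fin m → Fin m → Set where
  zero : ∀ {m} → Adjacent {suc (suc m)} zero (suc zero)
  suc  : ∀ {m} {i j : Fin m} → Adjacent i j → Adjacent (suc i) (suc j)

adjacent : ∀ {m} {i j : Fin m} → toℕ j ≡ suc (toℕ i) → Adjacent i j
adjacent {i = zero}  {zero}        ()
adjacent {i = zero}  {suc zero}    _  = zero
adjacent {i = zero}  {suc (suc _)} ()
adjacent {i = suc _} {zero}        ()
adjacent {i = suc _} {suc _}       eq = suc (adjacent (suc-injective eq))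

triple : ∀ {m} {i j : Fin m} → Adjacent i j → Vec Bool (suc m) → Bit³
triple zero    (x ∷ y ∷ z ∷ _) = x , y , z
triple (suc a) (_ ∷ v)         = triple a v

pair2-lower : ∀ {m} {i j : Fin m} (a : Adjacent i j) v → pair2 i v ≡ lower (triple a v)
pair2-lower zero    (_ ∷ _ ∷ _ ∷ _) = refl
pair2-lower (suc a) (_ ∷ v)         = pair2-lower a v

pair2-upper : ∀ {m} {i j : Fin m} (a : Adjacent i j) v → pair2 j v ≡ upper (triple a v)
pair2-upper zero    (_ ∷ _ ∷ _ ∷ _) = refl
pair2-upper (suc a) (_ ∷ v)         = pair2-upper a v

triple-upd-lower : ∀ {m} {i j : Fin m} (a : Adjacent i j) x y v →
                   triple a (upd i x y v) ≡ (x , y , proj₂ (proj₂ (triple a v)))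
triple-upd-lower zero    x y (_ ∷ _ ∷ _ ∷ _) = refl
triple-upd-lower (suc a) x y (_ ∷ v)         = triple-upd-lower a x y v

triple-upd-upper : ∀ {m} {i j : Fin m} (a : Adjacent i j) y z v →
                   triple a (upd j y z v) ≡ (proj₁ (triple a v) , y , z)
triple-upd-upper zero    y z (_ ∷ _ ∷ _ ∷ _) = refl
triple-upd-upper (suc a) y z (_ ∷ v)         = triple-upd-upper a y z v

e₁-triple : ∀ {m} {i j : Fin m} (a : Adjacent i j) c →
            e₁ (triple a (proj₁ c)) ≡ Maybe.map (triple a ∘ proj₁) (SSe i c)
e₁-triple {i = i} a (v , p) = begin
  e₁ (triple a v)
    ≡⟨ cong (Maybe.map keep-z ∘ eᵖ) (pair2-lower a v) ⟨
  Maybe.map keep-z (eᵖ (pair2 i v))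
    ≡⟨ map-cong (λ (x , y) → sym (triple-upd-lower a x y v)) (eᵖ (pair2 i v)) ⟩
  Maybe.map (triple a ∘ set-xy) (eᵖ (pair2 i v))
    ≡⟨ map-∘ (eᵖ (pair2 i v)) ⟩
  Maybe.map (triple a) (Maybe.map set-xy (eᵖ (pair2 i v)))
    ≡⟨ cong (Maybe.map (triple a)) (SSe-eᵖ i (v , p)) ⟨
  Maybe.map (triple a) (Maybe.map proj₁ (SSe i (v , p)))
    ≡⟨ map-∘ (SSe i (v , p)) ⟨
  Maybe.map (triple a ∘ proj₁) (SSe i (v , p))
    ∎
  where open ≡-Reasoning
        keep-z = uncurry′ λ x′ y′ → x′ , y′ , proj₂ (proj₂ (triple a v))
        set-xy = uncurry′ λ x′ y′ → upd i x′ y′ v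

e₂-triple : ∀ {m} {i j : Fin m} (a : Adjacent i j) c →
            e₂ (triple a (proj₁ c)) ≡ Maybe.map (triple a ∘ proj₁) (SSe j c)
e₂-triple {j = j} a (v , p) = begin
  e₂ (triple a v)
    ≡⟨ cong (Maybe.map keep-x ∘ eᵖ) (pair2-upper a v) ⟨
  Maybe.map keep-x (eᵖ (pair2 j v))
    ≡⟨ map-cong (λ (y , z) → sym (triple-upd-upper a y z v)) (eᵖ (pair2 j v)) ⟩
  Maybe.map (triple a ∘ set-yz) (eᵖ (pair2 j v))
    ≡⟨ map-∘ (eᵖ (pair2 j v)) ⟩
  Maybe.map (triple a) (Maybe.map set-yz (eᵖ (pair2 j v)))
    ≡⟨ cong (Maybe.map (triple a)) (SSe-eᵖ j (v , p)) ⟨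
  Maybe.map (triple a) (Maybe.map proj₁ (SSe j (v , p)))
    ≡⟨ map-∘ (SSe j (v , p)) ⟨
  Maybe.map (triple a ∘ proj₁) (SSe j (v , p))
    ∎
  where open ≡-Reasoning
        keep-x = uncurry′ λ y′ z′ → proj₁ (triple a v) , y′ , z′
        set-yz = uncurry′ λ y′ z′ → upd j y′ z′ v

double-+-suc : ∀ a s → (a + suc s) * 2 ≡ suc (suc ((a + s) * 2))
double-+-suc a s = cong (_* 2) (+-suc a s)

-- The invariant behind eʷ-Eʷ-adjacent: for a word w of triples with Lower.εʷ w ≡ 0, the
-- numbers A = φ₁ w, R = φ₂ w, S = φ₁ (E₂ w) and U = φ₂ (E₁ (E₂ w)) satisfy
-- A/2 − ⌈S/2⌉ = U/2 − ⌈R/2⌉ ≥ 0. slack-step prepends a letter t; its cases split t, R, S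
-- and s only as far as the ε-values of t (at most 2) can tell them apart.
Slack : ℕ → ℕ → ℕ → ℕ → Set
Slack A R S U = Σ ℕ λ s → A ≡ (⌈ S /2⌉ + s) * 2 × U ≡ (⌈ R /2⌉ + s) * 2

slack-step : ∀ t A R S U → ε₁ t ≤ A → Slack A R S U →
  let t′ = run (ε₂ t ∸ R) e₂ t ; t″ = run (ε₁ t′ ∸ S) e₁ t′ in
  ε₂ t″ ≤ U ×
  Slack (φ₁ t + (A ∸ ε₁ t)) (φ₂ t + (R ∸ ε₂ t)) (φ₁ t′ + (S ∸ ε₁ t′)) (φ₂ t″ + (U ∸ ε₂ t″))
slack-step (false , false , false) _ R             S             _ _             (s , refl , refl)
  rewrite 0∸n≡0 R | 0∸n≡0 S = z≤n , s , refl , refl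
slack-step (true , false , false)  _ R             S             _ _             (s , refl , refl)
  rewrite 0∸n≡0 R | 0∸n≡0 S = z≤n , s , refl , refl
slack-step (false , true , false)  _ R             zero          _ (s≤s (s≤s _)) (suc s , refl , refl)
  rewrite 0∸n≡0 R = z≤n , s , refl , double-+-suc ⌈ R /2⌉ s
slack-step (false , true , false)  _ R             (suc zero)    _ _             (s , refl , refl)
  rewrite 0∸n≡0 R = z≤n , s , refl , refl
slack-step (false , true , false)  _ R             (suc (suc S)) _ _             (s , refl , refl)
  rewrite 0∸n≡0 R | 0∸n≡0 S = z≤n , s , refl , refl
slack-step (true , true , false)   _ R             zero          _ (s≤s _)       (suc s , refl , refl)
  rewrite 0∸n≡0 R = z≤n , s , refl , double-+-suc ⌈ R /2⌉ s
slack-step (true , true , false)   _ R             (suc S)       _ _             (s , refl , refl)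
  rewrite 0∸n≡0 R | 0∸n≡0 S = z≤n , s , refl , refl
slack-step (false , false , true)  _ zero          zero          _ _             (s , refl , refl)
  = z≤n , s , refl , refl
slack-step (false , false , true)  _ zero          (suc zero)    _ _             (s , refl , refl)
  = z≤n , suc s , refl , refl
slack-step (false , false , true)  _ zero          (suc (suc S)) _ _             (s , refl , refl)
  rewrite 0∸n≡0 S = z≤n , suc s , sym (double-+-suc ⌈ S /2⌉ s) , refl
slack-step (false , false , true)  _ (suc zero)    zero          _ _             (s , refl , refl)
  = s≤s (s≤s z≤n) , s , refl , refl
slack-step (false , false , true)  _ (suc zero)    (suc zero)    _ _             (s , refl , refl)
  = s≤s z≤n , suc s , refl , refl
slack-step (false , false , true)  _ (suc zero)    (suc (suc S)) _ _             (s , refl , refl)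
  rewrite 0∸n≡0 S = s≤s z≤n , suc s , sym (double-+-suc ⌈ S /2⌉ s) , refl
slack-step (false , false , true)  _ (suc (suc R)) S             _ _             (s , refl , refl)
  rewrite 0∸n≡0 R | 0∸n≡0 S = s≤s (s≤s z≤n) , s , refl , refl
slack-step (true , false , true)   _ zero          zero          _ _             (s , refl , refl)
  = z≤n , s , refl , refl
slack-step (true , false , true)   _ zero          (suc S)       _ _             (s , refl , refl)
  rewrite 0∸n≡0 S = z≤n , suc s , sym (double-+-suc ⌈ suc S /2⌉ s) , refl
slack-step (true , false , true)   _ (suc zero)    zero          _ _             (s , refl , refl)
  = s≤s (s≤s z≤n) , s , refl , refl
slack-step (true , false , true)   _ (suc zero)    (suc S)       _ _             (s , refl , refl)
  rewrite 0∸n≡0 S = s≤s z≤n , suc s , sym (double-+-suc ⌈ suc S /2⌉ s) , refl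
slack-step (true , false , true)   _ (suc (suc R)) S             _ _             (s , refl , refl)
  rewrite 0∸n≡0 R | 0∸n≡0 S = s≤s (s≤s z≤n) , s , refl , refl
slack-step (false , true , true)   _ zero          zero          _ (s≤s (s≤s _)) (suc s , refl , refl)
  = z≤n , s , refl , refl
slack-step (false , true , true)   _ zero          (suc zero)    _ _             (s , refl , refl)
  = z≤n , s , refl , refl
slack-step (false , true , true)   _ zero          (suc (suc S)) _ _             (s , refl , refl)
  rewrite 0∸n≡0 S = z≤n , s , refl , refl
slack-step (false , true , true)   _ (suc R)       zero          _ (s≤s (s≤s _)) (suc s , refl , refl)
  rewrite 0∸n≡0 R = s≤s (s≤s z≤n) , s , refl , cong (_∸ 2) (double-+-suc ⌈ suc R /2⌉ s)
slack-step (false , true , true)   _ (suc R)       (suc zero)    _ _             (s , refl , refl)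
  rewrite 0∸n≡0 R = s≤s z≤n , s , refl , refl
slack-step (false , true , true)   _ (suc R)       (suc (suc S)) _ _             (s , refl , refl)
  rewrite 0∸n≡0 R | 0∸n≡0 S = s≤s z≤n , s , refl , refl
slack-step (true , true , true)    _ zero          zero          _ (s≤s _)       (suc s , refl , refl)
  = z≤n , s , refl , refl
slack-step (true , true , true)    _ zero          (suc S)       _ _             (s , refl , refl)
  rewrite 0∸n≡0 S = z≤n , s , refl , refl
slack-step (true , true , true)    _ (suc R)       zero          _ (s≤s _)       (suc s , refl , refl)
  rewrite 0∸n≡0 R = s≤s (s≤s z≤n) , s , refl , cong (_∸ 2) (double-+-suc ⌈ suc R /2⌉ s)
slack-step (true , true , true)    _ (suc R)       (suc S)       _ _             (s , refl , refl)
  rewrite 0∸n≡0 R | 0∸n≡0 S = s≤s z≤n , s , refl , refl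

module Lower = Signature ε₁ φ₁ e₁
module Upper = Signature ε₂ φ₂ e₂

adjacent-slack : ∀ w → Lower.εʷ w ≡ 0 →
  Upper.εʷ (Lower.Eʷ (Upper.Eʷ w)) ≡ 0 ×
  Slack (Lower.φʷ w) (Upper.φʷ w) (Lower.φʷ (Upper.Eʷ w)) (Upper.φʷ (Lower.Eʷ (Upper.Eʷ w)))
adjacent-slack []      _   = refl , 0 , refl , refl
adjacent-slack (t ∷ w) ε≡0 with adjacent-slack w (m+n≡0⇒m≡0 (Lower.εʷ w) ε≡0)
... | ε′≡0 , slack
  with slack-step t (Lower.φʷ w) (Upper.φʷ w) (Lower.φʷ (Upper.Eʷ w)) (Upper.φʷ (Lower.Eʷ (Upper.Eʷ w)))
                  (m∸n≡0⇒m≤n (m+n≡0⇒n≡0 (Lower.εʷ w) ε≡0)) slack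
...   | ε≤ , slack′ rewrite ε′≡0 = m≤n⇒m∸n≡0 ε≤ , slack′

module _ {m} {i j : Fin m} (a : Adjacent i j) where
  private
    toTriple : SSCarrier m → Bit³
    toTriple = triple a ∘ proj₁

    lower-toTriple : ∀ c → lower (toTriple c) ≡ pair2 i (proj₁ c)
    lower-toTriple c = sym (pair2-lower a (proj₁ c))

    upper-toTriple : ∀ c → upper (toTriple c) ≡ pair2 j (proj₁ c)
    upper-toTriple c = sym (pair2-upper a (proj₁ c))

    module ToLower = SignatureMorphism (εˢ i) (φˢ i) (SSe i) ε₁ φ₁ e₁ toTriple
      (cong εᵖ ∘ lower-toTriple) (cong φᵖ ∘ lower-toTriple) (e₁-triple a)
    module ToUpper = SignatureMorphism (εˢ j) (φˢ j) (SSe j) ε₂ φ₂ e₂ toTriple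
      (cong εᵖ ∘ upper-toTriple) (cong φᵖ ∘ upper-toTriple) (e₂-triple a)

  eʷ-Eʷ-adjacent : ∀ w → eʷ i w ≡ nothing → eʷ j (Eʷ i (Eʷ j w)) ≡ nothing
  eʷ-Eʷ-adjacent w eq = εʷ≡0⇒eʷ≡nothing j {Eʷ i (Eʷ j w)} (begin
    εʷ j (Eʷ i (Eʷ j w))
      ≡⟨ ToUpper.εʷ-map (Eʷ i (Eʷ j w)) ⟨
    Upper.εʷ (List.map toTriple (Eʷ i (Eʷ j w)))
      ≡⟨ cong Upper.εʷ (ToLower.Eʷ-map (Eʷ j w)) ⟨
    Upper.εʷ (Lower.Eʷ (List.map toTriple (Eʷ j w)))
      ≡⟨ cong (Upper.εʷ ∘ Lower.Eʷ) (ToUpper.Eʷ-map w) ⟨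
    Upper.εʷ (Lower.Eʷ (Upper.Eʷ (List.map toTriple w)))
      ≡⟨ proj₁ (adjacent-slack (List.map toTriple w) (trans (ToLower.εʷ-map w) (εʷ-nothing i {w} eq))) ⟩
    0
      ∎)
    where open ≡-Reasoning

module _ {m} (B : Crystal m) where
  open Crystal B

  E-kills : ∀ i x → e i (E B i x) ≡ nothing
  E-kills i x = run-StringLength (ε-sup i x)

  module _ (normal : Normal B) where
    open LocalWordModel B using (word-model)

    E-far : ∀ {i j} x → Far i j → e i x ≡ nothing → e i (E B j x) ≡ nothing
    E-far {i} {j} x far eq with word-model normal x
    ... | w , model = from (model (j ∷ []) i) (eʷ-Eʷ-far far w (to (model [] i) eq))

    E-adjacent : ∀ {i j} x → Adjacent i j → e i x ≡ nothing → e j (E B i (E B j x)) ≡ nothing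
    E-adjacent {i} {j} x a eq with word-model normal x
    ... | w , model = from (model (i ∷ j ∷ []) j) (eʷ-Eʷ-adjacent a w (to (model [] i) eq))

data Interval {m} : ℕ → ℕ → List (Fin m) → Set where
  []  : ∀ {k} → Interval (suc k) k []
  _∷_ : ∀ {j k a l} → toℕ a ≡ j → Interval (suc j) k l → Interval j k (a ∷ l)

interval-tabulate : ∀ {m n} (f : Fin n → Fin m) s → (∀ i → toℕ (f i) ≡ s + toℕ i) →
                    ∀ k → k < n → Interval s (s + k) (take (suc k) (tabulate f))
interval-tabulate {n = suc n} f s f≡ zero    _ rewrite +-identityʳ s =
  trans (f≡ zero) (+-identityʳ s) ∷ []
interval-tabulate {n = suc n} f s f≡ (suc k) (s≤s k<n) rewrite +-suc s k =
  trans (f≡ zero) (+-identityʳ s) ∷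
  interval-tabulate (f ∘ suc) (suc s) (λ i → trans (f≡ (suc i)) (+-suc s (toℕ i))) k k<n

module RectKills {m} (B : Crystal m)
  (E-kills : ∀ i x → Crystal.e B i (E B i x) ≡ nothing)
  (E-far : ∀ {i j} x → Far i j → Crystal.e B i x ≡ nothing → Crystal.e B i (E B j x) ≡ nothing)
  (E-adjacent : ∀ {i j} x → Adjacent i j → Crystal.e B i x ≡ nothing →
                Crystal.e B j (E B i (E B j x)) ≡ nothing)
  where
  open Crystal B

  KilledBelow : ℕ → Carrier → Set
  KilledBelow k x = ∀ i → toℕ i < k → e i x ≡ nothing

  Eseq-interval : ∀ {j k l x} → Interval j k l → KilledBelow k x →
                  ∀ i → toℕ i ≤ k → suc (toℕ i) ≢ j → e i (Eseq B l x) ≡ nothing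
  Eseq-interval-above : ∀ {j k a l x} → toℕ a ≡ j → Interval (suc j) k l → KilledBelow k x →
                        ∀ i → toℕ i ≤ k → j < toℕ i → e i (E B a (Eseq B l x)) ≡ nothing
  Eseq-interval-next : ∀ {j k a l x} → toℕ a ≡ j → Interval (suc j) k l → KilledBelow k x →
                       ∀ i → toℕ i ≤ k → toℕ i ≡ suc j → e i (E B a (Eseq B l x)) ≡ nothing

  Eseq-interval [] killed i i≤k i≢k = killed i (≤∧≢⇒< i≤k (i≢k ∘ cong suc))
  Eseq-interval {j} {x = x} (_∷_ {a = a} {l} a≡j int) killed i i≤k i+1≢j with <-cmp (toℕ i) j
  ... | tri≈ _ i≡j _ rewrite toℕ-injective (trans i≡j (sym a≡j)) = E-kills a (Eseq B l x)
  ... | tri< i<j _ _ =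
    E-far _ (inj₁ (subst (suc (toℕ i) <_) (sym a≡j) (≤∧≢⇒< i<j i+1≢j)))
            (Eseq-interval int killed i i≤k (<⇒≢ i<j ∘ suc-injective))
  ... | tri> _ _ j<i = Eseq-interval-above a≡j int killed i i≤k j<i

  Eseq-interval-above {j} a≡j int killed i i≤k j<i with toℕ i ≟ suc j
  ... | yes i≡j+1 = Eseq-interval-next a≡j int killed i i≤k i≡j+1
  ... | no i≢j+1 =
    E-far _ (inj₂ (subst (_< toℕ i) (cong suc (sym a≡j)) (≤∧≢⇒< j<i (i≢j+1 ∘ sym))))
            (Eseq-interval int killed i i≤k (λ eq → <⇒≢ j<i (sym (suc-injective eq))))

  Eseq-interval-next a≡j [] killed i i≤k i≡j+1 = ⊥-elim (1+n≰n (subst (_≤ _) i≡j+1 i≤k))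
  Eseq-interval-next {j} {a = a} a≡j (a′≡j+1 ∷ int) killed i i≤k i≡j+1 =
    subst (λ i′ → e i′ _ ≡ nothing) (toℕ-injective (trans a′≡j+1 (sym i≡j+1)))
      (E-adjacent _ (adjacent (trans a′≡j+1 (cong suc (sym a≡j))))
         (Eseq-interval int killed a a≤k (λ eq → 1+n≢n (trans (sym (suc-injective eq)) a≡j))))
    where a≤k = subst (_≤ _) (sym a≡j) (≤-trans (n≤1+n j) (subst (_≤ _) i≡j+1 i≤k))

  rectUpTo-kills : ∀ k → k ≤ m → ∀ b → KilledBelow k (rectUpTo B k b)
  rectUpTo-kills zero    _   _ _ ()
  rectUpTo-kills (suc k) k<m b i i≤k =
    Eseq-interval (interval-tabulate (λ i → i) 0 (λ _ → refl) k k<m) (rectUpTo-kills k (<⇒≤ k<m) b)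
                  i (≤-pred i≤k) (λ ())

theorem2p21 : (m : ℕ) (B : Crystal m) → Normal B →
                ∀ (b : Crystal.Carrier B) → HighestWeight B (rect B b)
theorem2p21 m B normal b i = rectUpTo-kills m ≤-refl b i (toℕ<n i)
  where open RectKills B (E-kills B) (E-far B normal) (E-adjacent B normal)
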